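{- For any $x,y\in\mathbb{Z}^n$, the $L$-distance $L\big(x,\lfloor\tfrac{x+y}{2}\rfloor\big)$ equals either $\lfloor\tfrac{L(x,y)}{2}\rfloor$ or $\lceil\tfrac{L(x,y)}{2}\rceil$.
   Context: For $x,y\in\mathbb{Z}^n$, $L(x,y)=\max_i(x_i-y_i)-\min_j(x_j-y_j)$, and $\lfloor\tfrac{x+y}{2}\rfloor$ denotes the vector $(\lfloor\tfrac{x_1+y_1}{2}\rfloor,\dots,\lfloor\tfrac{x_n+y_n}{2}\rfloor)$. -}

module Defs where

open import Data.Nat using (ℕ; zero; suc)
open import Data.Fin using (Fin)
import Data.Fin as F
open import Data.Integer using (ℤ; +_; _+_; _-_; _⊔_; _⊓_; _/ℕ_)

-- Vectors in ℤ^n, as functions Fin n → ℤ.  The max/min in L are over the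
-- coordinates, so the dimension is taken to be n ≥ 1 (written suc n).

maxᵥ : ∀ {n} → (Fin (suc n) → ℤ) → ℤ
maxᵥ {zero}  v = v F.zero
maxᵥ {suc n} v = v F.zero ⊔ maxᵥ (λ i → v (F.suc i))

minᵥ : ∀ {n} → (Fin (suc n) → ℤ) → ℤ
minᵥ {zero}  v = v F.zero
minᵥ {suc n} v = v F.zero ⊓ minᵥ (λ i → v (F.suc i))

L : ∀ {n} → (Fin (suc n) → ℤ) → (Fin (suc n) → ℤ) → ℤ
L x y = maxᵥ (λ i → x i - y i) - minᵥ (λ j → x j - y j)

-- floor(z/2) for integers (_/ℕ_ on ℤ is floor division by a positive natural)
⌊_/2⌋ : ℤ → ℤ
⌊ z /2⌋ = z /ℕ 2

⌈_/2⌉ : ℤ → ℤ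
⌈ z /2⌉ = (z + + 1) /ℕ 2

mid : ∀ {n} → (Fin (suc n) → ℤ) → (Fin (suc n) → ℤ) → (Fin (suc n) → ℤ)
mid x y i = ⌊ x i + y i /2⌋

-- Coordinatewise x_i - ⌊(x_i + y_i)/2⌋ = ⌈(x_i - y_i)/2⌉, and ⌈_/2⌉ is monotone,
-- so it commutes with max and min: L(x, mid x y) = ⌈M/2⌉ - ⌈m/2⌉, where M and m
-- are the largest and smallest coordinates of x - y.  Splitting on the parities
-- of M and m, this difference is ⌈(M - m)/2⌉ when M is odd and m even, and
-- ⌊(M - m)/2⌋ otherwise.
module Submission where

open import Defs
open import Data.Nat using (ℕ; suc)
open import Data.Fin using (Fin)
open import Data.Integer using (ℤ)
open import Data.Sum using (_⊎_)
open import Relation.Binary.PropositionalEquality using (_≡_)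

import Data.Nat as ℕ
open import Data.Fin as Fin using ()
open import Data.Integer
  using (+_; _+_; _-_; _*_; _⊔_; _⊓_; _/ℕ_; _%ℕ_; _≤_; _<_; +<+)
  renaming (suc to sucℤ)
open import Data.Integer.Properties
  using (≤-antisym; ≤-<-trans; i≤j+i; +-monoˡ-<; *-cancelʳ-<-nonNeg; suc-*;
         i<j⇒i≤pred[j]; pred-suc; +-monoˡ-≤; mono-≤-distrib-⊔; mono-≤-distrib-⊓)
open import Data.Integer.DivMod using (a≡a%ℕn+[a/ℕn]*n; n%ℕd<d; [n/ℕd]*d≤n; n<s[n/ℕd]*d)
open import Data.Integer.Tactic.RingSolver using (solve-∀)
open import Data.Sum using (inj₁; inj₂)
open import Function using (_∘_)
open import Relation.Binary.Definitions using (Monotonic₁)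
open import Relation.Binary.PropositionalEquality
  using (_≗_; refl; sym; trans; cong; cong₂; subst; module ≡-Reasoning)
open ≡-Reasoning

<sucℤ⇒≤ : ∀ {i j} → i < sucℤ j → i ≤ j
<sucℤ⇒≤ {i} {j} i<j+1 = subst (i ≤_) (pred-suc j) (i<j⇒i≤pred[j] i<j+1)

/ℕ-unique : ∀ {r} q d .{{_ : ℕ.NonZero d}} → r ℕ.< d → (+ r + q * + d) /ℕ d ≡ q
/ℕ-unique {r} q d r<d = ≤-antisym
  (<sucℤ⇒≤ (*-cancelʳ-<-nonNeg (+ d) (≤-<-trans ([n/ℕd]*d≤n z d) z<[1+q]*d)))
  (<sucℤ⇒≤ (*-cancelʳ-<-nonNeg (+ d) (≤-<-trans (i≤j+i (q * + d) (+ r)) (n<s[n/ℕd]*d z d))))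
  where
  z : ℤ
  z = + r + q * + d
  z<[1+q]*d : z < sucℤ q * + d
  z<[1+q]*d = subst (z <_) (sym (suc-* q (+ d))) (+-monoˡ-< (q * + d) (+<+ r<d))

/ℕ-monoˡ-≤ : ∀ d .{{_ : ℕ.NonZero d}} → Monotonic₁ _≤_ _≤_ (_/ℕ d)
/ℕ-monoˡ-≤ d {i} {j} i≤j = <sucℤ⇒≤ (*-cancelʳ-<-nonNeg (+ d)
  (≤-<-trans ([n/ℕd]*d≤n i d) (≤-<-trans i≤j (n<s[n/ℕd]*d j d))))

-- The summand + 0 makes both shapes instances of the one in /ℕ-unique.
data Parity : ℤ → Set where
  even : ∀ q → Parity (+ 0 + q * + 2)
  odd  : ∀ q → Parity (+ 1 + q * + 2)

parity : ∀ z → Parity z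
parity z with z %ℕ 2 | n%ℕd<d z 2 | a≡a%ℕn+[a/ℕn]*n z 2
... | 0           | _                  | z≡ = subst Parity (sym z≡) (even (z /ℕ 2))
... | 1           | _                  | z≡ = subst Parity (sym z≡) (odd (z /ℕ 2))
... | suc (suc _) | ℕ.s≤s (ℕ.s≤s ())  | _

⌊even/2⌋ : ∀ q → ⌊ + 0 + q * + 2 /2⌋ ≡ q
⌊even/2⌋ q = /ℕ-unique q 2 (ℕ.s≤s ℕ.z≤n)

⌊odd/2⌋ : ∀ q → ⌊ + 1 + q * + 2 /2⌋ ≡ q
⌊odd/2⌋ q = /ℕ-unique q 2 (ℕ.s≤s (ℕ.s≤s ℕ.z≤n))

⌈even/2⌉ : ∀ q → ⌈ + 0 + q * + 2 /2⌉ ≡ q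
⌈even/2⌉ q = begin
  ⌊ + 0 + q * + 2 + + 1 /2⌋ ≡⟨ cong ⌊_/2⌋ (shift q) ⟩
  ⌊ + 1 + q * + 2 /2⌋       ≡⟨ ⌊odd/2⌋ q ⟩
  q ∎
  where
  shift : ∀ q → + 0 + q * + 2 + + 1 ≡ + 1 + q * + 2
  shift = solve-∀

⌈odd/2⌉ : ∀ q → ⌈ + 1 + q * + 2 /2⌉ ≡ + 1 + q
⌈odd/2⌉ q = begin
  ⌊ + 1 + q * + 2 + + 1 /2⌋   ≡⟨ cong ⌊_/2⌋ (shift q) ⟩
  ⌊ + 0 + (+ 1 + q) * + 2 /2⌋ ≡⟨ ⌊even/2⌋ (+ 1 + q) ⟩
  + 1 + q ∎
  where
  shift : ∀ q → + 1 + q * + 2 + + 1 ≡ + 0 + (+ 1 + q) * + 2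
  shift = solve-∀

⌈/2⌉-mono-≤ : Monotonic₁ _≤_ _≤_ ⌈_/2⌉
⌈/2⌉-mono-≤ = /ℕ-monoˡ-≤ 2 ∘ +-monoˡ-≤ (+ 1)

i-⌊k/2⌋≡⌈2i-k/2⌉ : ∀ i k → i - ⌊ k /2⌋ ≡ ⌈ i * + 2 - k /2⌉
i-⌊k/2⌋≡⌈2i-k/2⌉ i k with parity k
... | even q = begin
  i - ⌊ + 0 + q * + 2 /2⌋          ≡⟨ cong (i -_) (⌊even/2⌋ q) ⟩
  i - q                             ≡˘⟨ ⌈even/2⌉ (i - q) ⟩
  ⌈ + 0 + (i - q) * + 2 /2⌉         ≡⟨ cong ⌈_/2⌉ (regroup i q) ⟩
  ⌈ i * + 2 - (+ 0 + q * + 2) /2⌉   ∎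
  where
  regroup : ∀ i q → + 0 + (i - q) * + 2 ≡ i * + 2 - (+ 0 + q * + 2)
  regroup = solve-∀
... | odd q = begin
  i - ⌊ + 1 + q * + 2 /2⌋          ≡⟨ cong (i -_) (⌊odd/2⌋ q) ⟩
  i - q                             ≡⟨ regroupˡ i q ⟩
  + 1 + (i - q - + 1)               ≡˘⟨ ⌈odd/2⌉ (i - q - + 1) ⟩
  ⌈ + 1 + (i - q - + 1) * + 2 /2⌉   ≡⟨ cong ⌈_/2⌉ (regroupʳ i q) ⟩
  ⌈ i * + 2 - (+ 1 + q * + 2) /2⌉   ∎
  where
  regroupˡ : ∀ i q → i - q ≡ + 1 + (i - q - + 1)
  regroupˡ = solve-∀
  regroupʳ : ∀ i q → + 1 + (i - q - + 1) * + 2 ≡ i * + 2 - (+ 1 + q * + 2)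
  regroupʳ = solve-∀

i-⌊i+j/2⌋≡⌈i-j/2⌉ : ∀ i j → i - ⌊ i + j /2⌋ ≡ ⌈ i - j /2⌉
i-⌊i+j/2⌋≡⌈i-j/2⌉ i j = begin
  i - ⌊ i + j /2⌋            ≡⟨ i-⌊k/2⌋≡⌈2i-k/2⌉ i (i + j) ⟩
  ⌈ i * + 2 - (i + j) /2⌉    ≡⟨ cong ⌈_/2⌉ (regroup i j) ⟩
  ⌈ i - j /2⌉                ∎
  where
  regroup : ∀ i j → i * + 2 - (i + j) ≡ i - j
  regroup = solve-∀

⌈i/2⌉-⌈j/2⌉≡⌊i-j/2⌋⊎⌈i-j/2⌉ : ∀ i j →
  (⌈ i /2⌉ - ⌈ j /2⌉ ≡ ⌊ i - j /2⌋) ⊎ (⌈ i /2⌉ - ⌈ j /2⌉ ≡ ⌈ i - j /2⌉)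
⌈i/2⌉-⌈j/2⌉≡⌊i-j/2⌋⊎⌈i-j/2⌉ i j with parity i | parity j
... | even p | even q = inj₁ (begin
  ⌈ + 0 + p * + 2 /2⌉ - ⌈ + 0 + q * + 2 /2⌉    ≡⟨ cong₂ _-_ (⌈even/2⌉ p) (⌈even/2⌉ q) ⟩
  p - q                                        ≡˘⟨ ⌊even/2⌋ (p - q) ⟩
  ⌊ + 0 + (p - q) * + 2 /2⌋                    ≡⟨ cong ⌊_/2⌋ (regroup p q) ⟩
  ⌊ (+ 0 + p * + 2) - (+ 0 + q * + 2) /2⌋      ∎)
  where
  regroup : ∀ p q → + 0 + (p - q) * + 2 ≡ (+ 0 + p * + 2) - (+ 0 + q * + 2)
  regroup = solve-∀
... | odd p | odd q = inj₁ (begin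
  ⌈ + 1 + p * + 2 /2⌉ - ⌈ + 1 + q * + 2 /2⌉    ≡⟨ cong₂ _-_ (⌈odd/2⌉ p) (⌈odd/2⌉ q) ⟩
  (+ 1 + p) - (+ 1 + q)                        ≡⟨ regroupˡ p q ⟩
  p - q                                        ≡˘⟨ ⌊even/2⌋ (p - q) ⟩
  ⌊ + 0 + (p - q) * + 2 /2⌋                    ≡⟨ cong ⌊_/2⌋ (regroupʳ p q) ⟩
  ⌊ (+ 1 + p * + 2) - (+ 1 + q * + 2) /2⌋      ∎)
  where
  regroupˡ : ∀ p q → (+ 1 + p) - (+ 1 + q) ≡ p - q
  regroupˡ = solve-∀
  regroupʳ : ∀ p q → + 0 + (p - q) * + 2 ≡ (+ 1 + p * + 2) - (+ 1 + q * + 2)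
  regroupʳ = solve-∀
... | even p | odd q = inj₁ (begin
  ⌈ + 0 + p * + 2 /2⌉ - ⌈ + 1 + q * + 2 /2⌉    ≡⟨ cong₂ _-_ (⌈even/2⌉ p) (⌈odd/2⌉ q) ⟩
  p - (+ 1 + q)                                ≡˘⟨ ⌊odd/2⌋ (p - (+ 1 + q)) ⟩
  ⌊ + 1 + (p - (+ 1 + q)) * + 2 /2⌋            ≡⟨ cong ⌊_/2⌋ (regroup p q) ⟩
  ⌊ (+ 0 + p * + 2) - (+ 1 + q * + 2) /2⌋      ∎)
  where
  regroup : ∀ p q → + 1 + (p - (+ 1 + q)) * + 2 ≡ (+ 0 + p * + 2) - (+ 1 + q * + 2)
  regroup = solve-∀
... | odd p | even q = inj₂ (begin
  ⌈ + 1 + p * + 2 /2⌉ - ⌈ + 0 + q * + 2 /2⌉    ≡⟨ cong₂ _-_ (⌈odd/2⌉ p) (⌈even/2⌉ q) ⟩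
  (+ 1 + p) - q                                ≡⟨ regroupˡ p q ⟩
  + 1 + (p - q)                                ≡˘⟨ ⌈odd/2⌉ (p - q) ⟩
  ⌈ + 1 + (p - q) * + 2 /2⌉                    ≡⟨ cong ⌈_/2⌉ (regroupʳ p q) ⟩
  ⌈ (+ 1 + p * + 2) - (+ 0 + q * + 2) /2⌉      ∎)
  where
  regroupˡ : ∀ p q → (+ 1 + p) - q ≡ + 1 + (p - q)
  regroupˡ = solve-∀
  regroupʳ : ∀ p q → + 1 + (p - q) * + 2 ≡ (+ 1 + p * + 2) - (+ 0 + q * + 2)
  regroupʳ = solve-∀

maxᵥ-cong : ∀ {n} {u v : Fin (suc n) → ℤ} → u ≗ v → maxᵥ u ≡ maxᵥ v
maxᵥ-cong {ℕ.zero} u≗v = u≗v Fin.zero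
maxᵥ-cong {suc n}  u≗v = cong₂ _⊔_ (u≗v Fin.zero) (maxᵥ-cong (u≗v ∘ Fin.suc))

minᵥ-cong : ∀ {n} {u v : Fin (suc n) → ℤ} → u ≗ v → minᵥ u ≡ minᵥ v
minᵥ-cong {ℕ.zero} u≗v = u≗v Fin.zero
minᵥ-cong {suc n}  u≗v = cong₂ _⊓_ (u≗v Fin.zero) (minᵥ-cong (u≗v ∘ Fin.suc))

mono-≤-distrib-maxᵥ : ∀ {n f} → Monotonic₁ _≤_ _≤_ f →
                      (v : Fin (suc n) → ℤ) → maxᵥ (f ∘ v) ≡ f (maxᵥ v)
mono-≤-distrib-maxᵥ {ℕ.zero}        f-mono v = refl
mono-≤-distrib-maxᵥ {suc n} {f = f} f-mono v = begin
  f (v Fin.zero) ⊔ maxᵥ (f ∘ v ∘ Fin.suc)    ≡⟨ cong (f (v Fin.zero) ⊔_) (mono-≤-distrib-maxᵥ f-mono (v ∘ Fin.suc)) ⟩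
  f (v Fin.zero) ⊔ f (maxᵥ (v ∘ Fin.suc))    ≡˘⟨ mono-≤-distrib-⊔ f-mono (v Fin.zero) (maxᵥ (v ∘ Fin.suc)) ⟩
  f (maxᵥ v)                                 ∎

mono-≤-distrib-minᵥ : ∀ {n f} → Monotonic₁ _≤_ _≤_ f →
                      (v : Fin (suc n) → ℤ) → minᵥ (f ∘ v) ≡ f (minᵥ v)
mono-≤-distrib-minᵥ {ℕ.zero}        f-mono v = refl
mono-≤-distrib-minᵥ {suc n} {f = f} f-mono v = begin
  f (v Fin.zero) ⊓ minᵥ (f ∘ v ∘ Fin.suc)    ≡⟨ cong (f (v Fin.zero) ⊓_) (mono-≤-distrib-minᵥ f-mono (v ∘ Fin.suc)) ⟩
  f (v Fin.zero) ⊓ f (minᵥ (v ∘ Fin.suc))    ≡˘⟨ mono-≤-distrib-⊓ f-mono (v Fin.zero) (minᵥ (v ∘ Fin.suc)) ⟩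
  f (minᵥ v)                                 ∎

L[x,mid[x,y]]≡⌈max/2⌉-⌈min/2⌉ : ∀ {n} (x y : Fin (suc n) → ℤ) →
  L x (mid x y) ≡ ⌈ maxᵥ (λ i → x i - y i) /2⌉ - ⌈ minᵥ (λ i → x i - y i) /2⌉
L[x,mid[x,y]]≡⌈max/2⌉-⌈min/2⌉ {n} x y = cong₂ _-_
  (trans (maxᵥ-cong x-mid≗⌈d/2⌉) (mono-≤-distrib-maxᵥ ⌈/2⌉-mono-≤ d))
  (trans (minᵥ-cong x-mid≗⌈d/2⌉) (mono-≤-distrib-minᵥ ⌈/2⌉-mono-≤ d))
  where
  d : Fin (suc n) → ℤ
  d i = x i - y i
  x-mid≗⌈d/2⌉ : (λ i → x i - mid x y i) ≗ ⌈_/2⌉ ∘ d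
  x-mid≗⌈d/2⌉ i = i-⌊i+j/2⌋≡⌈i-j/2⌉ (x i) (y i)

mainTheorem11 : ∀ (n : ℕ) (x y : Fin (suc n) → ℤ) →
    (L x (mid x y) ≡ ⌊ L x y /2⌋) ⊎ (L x (mid x y) ≡ ⌈ L x y /2⌉)
mainTheorem11 n x y rewrite L[x,mid[x,y]]≡⌈max/2⌉-⌈min/2⌉ x y =
  ⌈i/2⌉-⌈j/2⌉≡⌊i-j/2⌋⊎⌈i-j/2⌉ (maxᵥ (λ i → x i - y i)) (minᵥ (λ i → x i - y i))
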